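{- For any integers $x,y$ with $1\le x<y$ there exist a positive integer $f$ and an odd positive integer $q$ such that \[ (q-1)\cdot 2^{f-1}<x\le q\cdot 2^{f-1}<y\le (q+1)\cdot 2^{f-1}\,. \] Moreover, $f$ and $q$ are uniquely determined by $x$ and $y$. -}

module Defs where

open import Data.Nat using (ℕ; suc; _+_; _*_; _∸_; _^_; _<_; _≤_)
open import Data.Product using (∃; _×_)
open import Relation.Binary.PropositionalEquality using (_≡_)

Odd : ℕ → Set
Odd q = ∃ λ k → q ≡ 2 * k + 1

Good : ℕ → ℕ → ℕ → ℕ → Set
Good x y f q =
  1 ≤ f × Odd q ×
  ((q ∸ 1) * 2 ^ (f ∸ 1) < x) ×
  (x ≤ q * 2 ^ (f ∸ 1)) ×
  (q * 2 ^ (f ∸ 1) < y) ×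
  (y ≤ (q + 1) * 2 ^ (f ∸ 1))

-- Shift to a = x − 1 < b = y − 1 and e = f − 1: the conditions say that q · 2^e lies in
-- (a, b] while a and b both lie in the dyadic interval [(q − 1) 2^e, (q + 1) 2^e).
-- Existence: halve a and b until they have the same half i; then a = 2i, b = 2i + 1 and
-- (e, q) = (0, 2i + 1), and each undone halving doubles the interval, raising e by one.
-- Uniqueness: if (e, q) and (e′, q′) both work with e ≤ e′, then q′ 2^e′ ∈ (a, b] lies
-- strictly inside ((q − 1) 2^e, (q + 1) 2^e), so q′ 2^(e′ − e) = q, which is odd only if e′ = e.
module Submission where

open import Defs
open import Data.Nat using (ℕ; zero; suc; _+_; _*_; _∸_; _^_; _≤_; _<_; s≤s; z≤n; >-nonZero)
open import Data.Nat.Properties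
open import Data.Nat.DivMod using (_/_; _%_; m≡m%n+[m/n]*n; m%n<n; m/n<m)
open import Data.Nat.Induction using (<-rec)
open import Data.Product using (Σ; ∃₂; _×_; _,_; map)
open import Data.Sum using (inj₁; inj₂)
open import Function using (id)
open import Relation.Nullary using (contradiction)
open import Relation.Binary.Definitions using (tri<; tri≈; tri>)
open import Relation.Binary.PropositionalEquality using (_≡_; refl; sym; trans; cong; subst; subst₂)

record Splits (e q a b : ℕ) : Set where
  constructor splits
  field
    odd      : Odd q
    start≤a  : (q ∸ 1) * 2 ^ e ≤ a
    a<point  : a < q * 2 ^ e
    point≤b  : q * 2 ^ e ≤ b
    b<end    : b < (q + 1) * 2 ^ e

open Splits

splits⇒good : ∀ {e q a b} → Splits e q a b → Good (suc a) (suc b) (suc e) q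
splits⇒good (splits odd lo a< ≤b b<) = s≤s z≤n , odd , s≤s lo , a< , s≤s ≤b , b<

good⇒splits : ∀ {e q a b} → Good (suc a) (suc b) (suc e) q → Splits e q a b
good⇒splits (_ , odd , lo , a< , ≤b , b<) = splits odd (≤-pred lo) a< (≤-pred ≤b) b<

-- Writing n as n % 2 + (n / 2) * 2 makes suc i * 2 ≡ 2 + i * 2 definitional.
*2-≤-bit+*2 : ∀ {m i} r → m ≤ i → m * 2 ≤ r + i * 2
*2-≤-bit+*2 {i = i} r m≤i = ≤-trans (*-monoˡ-≤ 2 m≤i) (m≤n+m (i * 2) r)

bit+*2-<-*2 : ∀ {i m r} → r < 2 → i < m → r + i * 2 < m * 2
bit+*2-<-*2 {i} r<2 i<m = <-≤-trans (+-monoˡ-< (i * 2) r<2) (*-monoˡ-≤ 2 i<m)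

*2^suc : ∀ m e → m * 2 ^ suc e ≡ m * 2 ^ e * 2
*2^suc m e = trans (cong (m *_) (*-comm 2 (2 ^ e))) (sym (*-assoc m (2 ^ e) 2))

splits-double : ∀ {e q i j r s} → r < 2 → s < 2 →
  Splits e q i j → Splits (suc e) q (r + i * 2) (s + j * 2)
splits-double {e} {q} {i} {j} {r} {s} r<2 s<2 (splits odd lo i< ≤j j<) = splits odd
  (subst (_≤ r + i * 2) (sym (*2^suc (q ∸ 1) e)) (*2-≤-bit+*2 r lo))
  (subst (r + i * 2 <_) (sym (*2^suc q e)) (bit+*2-<-*2 r<2 i<))
  (subst (_≤ s + j * 2) (sym (*2^suc q e)) (*2-≤-bit+*2 s ≤j))
  (subst (s + j * 2 <_) (sym (*2^suc (q + 1) e)) (bit+*2-<-*2 s<2 j<))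

odd-1+*2 : ∀ i → Odd (1 + i * 2)
odd-1+*2 i = i , trans (+-comm 1 (i * 2)) (cong (_+ 1) (*-comm i 2))

splits-0 : ∀ {n} → Odd (suc n) → Splits 0 (suc n) n (suc n)
splits-0 {n} odd = splits odd
  (≤-reflexive (*-identityʳ n))
  (s≤s (≤-reflexive (sym (*-identityʳ n))))
  (s≤s (≤-reflexive (*-identityʳ n)))
  (≤-trans (m<m+n (suc n) (s≤s z≤n)) (≤-reflexive (sym (*-identityʳ (suc n + 1)))))

bits-< : ∀ {r s} → r < s → s < 2 → r ≡ 0 × s ≡ 1
bits-< {zero} {suc zero} _ _ = refl , refl
bits-< {suc _} {suc zero} (s≤s ()) _
bits-< {_} {suc (suc _)} _ (s≤s (s≤s ()))

Splittable : ℕ → ℕ → Set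
Splittable a b = ∃₂ λ e q → Splits e q a b

splittable-halves : ∀ {r s i j} → r < 2 → s < 2 → r + i * 2 < s + j * 2 →
  (i < j → Splittable i j) → Splittable (r + i * 2) (s + j * 2)
splittable-halves {r} {s} {i} {j} r<2 s<2 a<b splittable with <-cmp i j
... | tri< i<j _ _ = let e , q , S = splittable i<j in suc e , q , splits-double r<2 s<2 S
... | tri> _ _ j<i =
  contradiction a<b (<-asym (<-≤-trans (bit+*2-<-*2 {r = s} s<2 j<i) (m≤n+m (i * 2) r)))
... | tri≈ _ refl _ with refl , refl ← bits-< (+-cancelʳ-< (i * 2) r s a<b) s<2 =
  0 , suc (i * 2) , splits-0 (odd-1+*2 i)

splittable : ∀ {a b} → a < b → Splittable a b
splittable {a} {b} = <-rec P step b
  where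
  P : ℕ → Set
  P b = ∀ {a} → a < b → Splittable a b
  halve : ∀ n → n ≡ n % 2 + n / 2 * 2
  halve n = m≡m%n+[m/n]*n n 2
  step : ∀ b → (∀ {b′} → b′ < b → P b′) → P b
  step b rec {a} a<b =
    subst₂ Splittable (sym (halve a)) (sym (halve b))
      (splittable-halves {i = a / 2} (m%n<n a 2) (m%n<n b 2) (subst₂ _<_ (halve a) (halve b) a<b)
        (rec (m/n<m b 2 ⦃ >-nonZero (≤-trans (s≤s z≤n) a<b) ⦄ (s≤s (s≤s z≤n)))))

pred<m<suc⇒m≡ : ∀ {q m} → q ∸ 1 < m → m < q + 1 → m ≡ q
pred<m<suc⇒m≡ {zero} {suc _} _ (s≤s ())
pred<m<suc⇒m≡ {suc q} {m} q<m m<q+2 =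
  ≤-antisym (m<1+n⇒m≤n (subst (m <_) (+-comm (suc q) 1) m<q+2)) q<m

odd-*2^⇒≡0 : ∀ m d → Odd (m * 2 ^ d) → d ≡ 0
odd-*2^⇒≡0 m zero _ = refl
odd-*2^⇒≡0 m (suc d) (k , odd) = contradiction
  (trans (*-comm 2 (m * 2 ^ d)) (trans (sym (*2^suc m d)) (trans odd (+-comm (2 * k) 1))))
  (even≢odd (m * 2 ^ d) k)

splits-point-unique : ∀ {e q q′ a b} d → Splits e q a b →
  a < q′ * 2 ^ (e + d) → q′ * 2 ^ (e + d) ≤ b → e + d ≡ e × q′ ≡ q
splits-point-unique {e} {q} {q′} {a} {b} d (splits odd lo _ _ hi) a< ≤b =
  trans (cong (e +_) d≡0) (+-identityʳ e) ,
  trans (sym (*-identityʳ q′)) (subst (λ d → q′ * 2 ^ d ≡ q) d≡0 q′2^d≡q)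
  where
  point : q′ * 2 ^ (e + d) ≡ q′ * 2 ^ d * 2 ^ e
  point = trans (cong (q′ *_) (trans (^-distribˡ-+-* 2 e d) (*-comm (2 ^ e) (2 ^ d))))
                (sym (*-assoc q′ (2 ^ d) (2 ^ e)))
  q′2^d≡q : q′ * 2 ^ d ≡ q
  q′2^d≡q = pred<m<suc⇒m≡
    (*-cancelʳ-< (2 ^ e) _ _ (≤-<-trans lo (subst (a <_) point a<)))
    (*-cancelʳ-< (2 ^ e) _ _ (≤-<-trans (subst (_≤ b) point ≤b) hi))
  d≡0 : d ≡ 0
  d≡0 = odd-*2^⇒≡0 q′ d (subst Odd (sym q′2^d≡q) odd)

splits-unique : ∀ {e q e′ q′ a b} → Splits e q a b → Splits e′ q′ a b → e′ ≡ e × q′ ≡ q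
splits-unique {e} {e′ = e′} S S′ with ≤-total e e′
... | inj₁ e≤e′ with d , refl ← m≤n⇒∃[o]m+o≡n e≤e′ =
  splits-point-unique d S (a<point S′) (point≤b S′)
... | inj₂ e′≤e with d , refl ← m≤n⇒∃[o]m+o≡n e′≤e =
  map sym sym (splits-point-unique d S′ (a<point S) (point≤b S))

lemma4p6 : (x y : ℕ) → 1 ≤ x → x < y →
    Σ ℕ (λ f → Σ ℕ (λ q → Good x y f q ×
      ((f′ q′ : ℕ) → Good x y f′ q′ → (f′ ≡ f) × (q′ ≡ q))))
lemma4p6 (suc a) (suc b) _ (s≤s a<b) with e , q , S ← splittable a<b =
  suc e , q , splits⇒good S , unique
  where
  unique : (f′ q′ : ℕ) → Good (suc a) (suc b) f′ q′ → (f′ ≡ suc e) × (q′ ≡ q)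
  unique (suc e′) q′ G = map (cong suc) id (splits-unique S (good⇒splits G))
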